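{- Let $G=(V,E)$ be a graph with arboricity $\alpha$ containing $T$ triangles, and let $\tau>0$. Then the number of $\tau$-heavy triangles in $G$ is at most $\frac{3T\alpha}{\tau}$.
   Context: The arboricity of a graph is the minimum number of forests into which its edge set can be partitioned. For an edge $e$, let $T_e$ denote the number of triangles of $G$ containing $e$. An edge $e$ is $\tau$-heavy if $T_e>\tau$, and $\tau$-light if $T_e\le\tau$. A triangle is $\tau$-heavy if all three of its edges are $\tau$-heavy; otherwise it is $\tau$-light.
   Formalization: The threshold τ ranges over the positive rationals. -}

module Defs where

open import Data.Nat using (ℕ; zero; suc; _+_; _≤_; _<ᵇ_)
open import Data.Bool using (Bool; true; false; _∧_; if_then_else_)
open import Data.Fin using (Fin; inject₁; fromℕ) renaming (zero to fzero; suc to fsuc)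
open import Data.Fin.Base using (toℕ)
open import Data.List using (List; map; allFin)
open import Data.Nat.ListAction using (sum)
open import Data.Product using (Σ; _×_; ∃-syntax)
open import Data.Integer using (+_)
open import Data.Rational using (ℚ; _/_; _<_)
open import Data.Rational.Properties using (_<?_)
open import Relation.Nullary using (¬_; does)
open import Relation.Binary.PropositionalEquality using (_≡_)
open import Function.Definitions using (Injective)

record Graph (n : ℕ) : Set where
  field
    adj    : Fin n → Fin n → Bool
    sym    : ∀ u v → adj u v ≡ adj v u
    irrefl : ∀ v → adj v v ≡ false
open Graph public

toℚ : ℕ → ℚ
toℚ k = (+ k) / 1

count : ∀ {n} → (Fin n → Bool) → ℕ
count {n} p = sum (map (λ x → if p x then 1 else 0) (allFin n))

countTriangles : ∀ {n} → Graph n → (Fin n → Fin n → Fin n → Bool) → ℕ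
countTriangles {n} G p =
  sum (map (λ i → sum (map (λ j → count (λ k →
      (toℕ i <ᵇ toℕ j) ∧ (toℕ j <ᵇ toℕ k)
      ∧ adj G i j ∧ adj G j k ∧ adj G i k ∧ p i j k))
    (allFin n))) (allFin n))

numTriangles : ∀ {n} → Graph n → ℕ
numTriangles G = countTriangles G (λ _ _ _ → true)

-- T_e for the edge e = {u,v}: number of triangles containing e,
-- i.e. number of common neighbours w of u and v
edgeTriangles : ∀ {n} → Graph n → Fin n → Fin n → ℕ
edgeTriangles G u v = count (λ w → adj G u w ∧ adj G v w)

heavyEdge : ∀ {n} → Graph n → ℚ → Fin n → Fin n → Bool
heavyEdge G τ u v = does (τ <? toℚ (edgeTriangles G u v))

numHeavyTriangles : ∀ {n} → Graph n → ℚ → ℕ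
numHeavyTriangles G τ = countTriangles G (λ i j k →
  heavyEdge G τ i j ∧ heavyEdge G τ j k ∧ heavyEdge G τ i k)

HasCycle : ∀ {n} → (Fin n → Fin n → Set) → Set
HasCycle {n} R = Σ ℕ λ m → Σ (Fin (suc (suc (suc m))) → Fin n) λ f →
  Injective _≡_ _≡_ f
  × (∀ (i : Fin (suc (suc m))) → R (f (inject₁ i)) (f (fsuc i)))
  × R (f (fromℕ (suc (suc m)))) (f fzero)

-- The edge set of G can be partitioned into k forests: each edge gets one of k
-- colours (well defined on the unordered edge), and each colour class is acyclic.
ForestDecomposition : ∀ {n} → Graph n → ℕ → Set
ForestDecomposition {n} G k = Σ (Fin n → Fin n → Fin k) λ c →
  (∀ u v → adj G u v ≡ true → c u v ≡ c v u)
  × (∀ (j : Fin k) → ¬ HasCycle (λ u v → (adj G u v ≡ true) × (c u v ≡ j)))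

IsArboricity : ∀ {n} → Graph n → ℕ → Set
IsArboricity G α = ForestDecomposition G α × (∀ k → ForestDecomposition G k → α ≤ k)

-- Orient every forest of a decomposition of G into α forests by repeatedly removing a leaf
-- (an acyclic graph always has one, since a walk that never turns back closes a cycle): this
-- orients G with all out-degrees at most α. Each triangle then contains a directed path
-- a → b → c, and in a τ-heavy triangle the arc a → b is heavy; so a heavy triangle is
-- determined by a heavy arc and an out-neighbour of its head, and there are at most
-- (number of heavy arcs) · α of them. Every heavy arc lies in more than τ triangles and every
-- triangle has three edges, so (number of heavy arcs) · τ ≤ 3T.

module Submission where

open import Algebra.Bundles using (CommutativeMonoid)
open import Data.Bool using (Bool; true; false; _∧_; if_then_else_)
import Data.Bool as Bool
open import Data.Bool.Properties using (∧-comm; ∧-zeroʳ; ∧-identityʳ; ∧-commutativeMonoid)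
open import Data.Empty using (⊥-elim)
open import Data.Fin using (Fin; zero; suc; toℕ; inject₁; fromℕ)
import Data.Fin.Properties as Fin
open import Data.Fin.Subset using (Subset; _∈_; _∉_; _-_; ∣_∣; ⊤)
open import Data.Fin.Subset.Properties
  using (_∈?_; nonempty?; ∈⊤; ∣p∣≤n; x∈p∧x≢y⇒x∈p-y; x∈p⇒∣p-x∣<∣p∣)
import Data.Integer as ℤ
import Data.Integer.Properties as ℤP
open import Data.List using (allFin; tabulate)
import Data.List as List
open import Data.List.Properties using (map-tabulate)
open import Data.Nat using (ℕ; zero; suc; _+_; _*_; _∸_; _≤_; _<_; _<ᵇ_; z≤n; s≤s; s≤s⁻¹; s<s⁻¹)
import Data.Nat.Coprimality as Coprime
open import Data.Nat.Induction using (<-rec)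
open import Data.Nat.ListAction using () renaming (sum to listSum)
open import Data.Nat.Properties
open import Data.Nat.Tactic.RingSolver using (solve-∀)
open import Data.Product using (_×_; _,_; proj₁; proj₂; ∃; ∃₂)
open import Data.Rational as ℚ using (ℚ; mkℚ; toℚᵘ)
import Data.Rational.Properties as ℚP
open import Data.Rational.Unnormalised as ℚᵘ using (mkℚᵘ; *≡*)
import Data.Rational.Unnormalised.Properties as ℚᵘP
open import Data.Sum using (_⊎_; inj₁; inj₂)
open import Function using (_∘_; id)
open import Function.Definitions using (Injective)
open import Relation.Binary using (tri<; tri≈; tri>)
open import Relation.Binary.PropositionalEquality
open import Relation.Nullary using (¬_; ¬?; Dec; yes; no; does)
open import Relation.Nullary.Decidable using (dec-true; dec-false; decidable-stable; _×-dec_)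
open import Relation.Unary using (Decidable)

open import Defs hiding (sym)

open import Algebra.Properties.Semiring.Sum +-*-semiring
  using (sum-syntax; sum-cong-≗; sum-replicate-zero; ∑-comm; ∑-distrib-+; *-distribˡ-sum; *-distribʳ-sum)
open import Algebra.Properties.CommutativeSemigroup +-commutativeSemigroup using (x∙yz≈y∙xz)
open import Algebra.Properties.CommutativeSemigroup (CommutativeMonoid.commutativeSemigroup ∧-commutativeMonoid)
  using () renaming (x∙yz≈z∙yx to ∧-reverse; x∙yz≈z∙xy to ∧-rotate)

𝟙 : Bool → ℕ
𝟙 b = if b then 1 else 0

𝟙-∧ : ∀ a b → 𝟙 (a ∧ b) ≡ 𝟙 a * 𝟙 b
𝟙-∧ true  b = sym (+-identityʳ (𝟙 b))
𝟙-∧ false b = refl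

𝟙-∧-∧ : ∀ a b r → 𝟙 (a ∧ b ∧ r) ≡ 𝟙 (a ∧ b) * 𝟙 r
𝟙-∧-∧ true  b r = 𝟙-∧ b r
𝟙-∧-∧ false b r = refl

𝟙≤1 : ∀ b → 𝟙 b ≤ 1
𝟙≤1 true  = ≤-refl
𝟙≤1 false = z≤n

𝟙-≤ : ∀ {b m} → (b ≡ true → 1 ≤ m) → 𝟙 b ≤ m
𝟙-≤ {true}  1≤m = 1≤m refl
𝟙-≤ {false} _   = z≤n

∧-true⁻¹ : ∀ {a b} → a ∧ b ≡ true → a ≡ true × b ≡ true
∧-true⁻¹ {true} b≡true = refl , b≡true

dec-true⁻¹ : ∀ {P : Set} (P? : Dec P) → does P? ≡ true → P
dec-true⁻¹ (yes p) _ = p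
dec-true⁻¹ (no _)  ()

∑-mono-≤ : ∀ {n} {f g : Fin n → ℕ} → (∀ i → f i ≤ g i) → ∑[ i < n ] f i ≤ ∑[ i < n ] g i
∑-mono-≤ {zero}  f≤g = z≤n
∑-mono-≤ {suc n} f≤g = +-mono-≤ (f≤g zero) (∑-mono-≤ (f≤g ∘ suc))

term≤∑ : ∀ {n} (f : Fin n → ℕ) i → f i ≤ ∑[ j < n ] f j
term≤∑ f zero    = m≤m+n (f zero) _
term≤∑ f (suc i) = m≤n⇒m≤o+n (f zero) (term≤∑ (f ∘ suc) i)

∑-const-1 : ∀ k → ∑[ j < k ] 1 ≡ k
∑-const-1 zero    = refl
∑-const-1 (suc k) = cong suc (∑-const-1 k)

∑²-*ʳ : ∀ {m n} c (F : Fin m → Fin n → ℕ) →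
        ∑[ a < m ] ∑[ b < n ] (F a b * c) ≡ (∑[ a < m ] ∑[ b < n ] F a b) * c
∑²-*ʳ {n = n} c F =
  sym (trans (*-distribʳ-sum c (λ a → ∑[ b < n ] F a b)) (sum-cong-≗ λ a → *-distribʳ-sum c (F a)))

listSum-tabulate : ∀ {n} (f : Fin n → ℕ) → listSum (tabulate f) ≡ ∑[ i < n ] f i
listSum-tabulate {zero}  f = refl
listSum-tabulate {suc n} f = cong (f zero +_) (listSum-tabulate (f ∘ suc))

listSum-allFin : ∀ {n} (f : Fin n → ℕ) → listSum (List.map f (allFin n)) ≡ ∑[ i < n ] f i
listSum-allFin f = trans (cong listSum (map-tabulate id f)) (listSum-tabulate f)

count≡∑𝟙 : ∀ {n} (p : Fin n → Bool) → count p ≡ ∑[ x < n ] 𝟙 (p x)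
count≡∑𝟙 p = listSum-allFin (𝟙 ∘ p)

AtMostOne : ∀ {n} → (Fin n → Set) → Set
AtMostOne P = ∀ {x y} → P x → P y → x ≡ y

∑𝟙≤1 : ∀ {n} (p : Fin n → Bool) → AtMostOne (λ x → p x ≡ true) → ∑[ x < n ] 𝟙 (p x) ≤ 1
∑𝟙≤1 {zero}  p unique = z≤n
∑𝟙≤1 {suc n} p unique with p zero in p₀
... | false = ∑𝟙≤1 (p ∘ suc) (λ px py → Fin.suc-injective (unique px py))
... | true  = s≤s (≤-trans (∑-mono-≤ rest≤0) (≤-reflexive (sum-replicate-zero n)))
  where
  rest≤0 : ∀ x → 𝟙 (p (suc x)) ≤ 0
  rest≤0 x with p (suc x) in pₓ
  ... | false = z≤n
  ... | true  with () ← unique p₀ pₓ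

-- Symmetrising functions of three arguments

Triple : Set → Set
Triple A = A → A → A → ℕ

module _ {A : Set} where

  infixr 6 _⊕_
  infixr 7 _⊗_

  _⊕_ _⊗_ : Triple A → Triple A → Triple A
  (f ⊕ g) x y z = f x y z + g x y z
  (f ⊗ g) x y z = f x y z * g x y z

  swap₁₂ swap₂₃ : Triple A → Triple A
  swap₁₂ f x y z = f y x z
  swap₂₃ f x y z = f x z y

  symmetrise : Triple A → Triple A
  symmetrise f = f ⊕ swap₁₂ f ⊕ swap₂₃ f
                ⊕ swap₁₂ (swap₂₃ f) ⊕ swap₂₃ (swap₁₂ f) ⊕ swap₁₂ (swap₂₃ (swap₁₂ f))

  term≤symmetrise : ∀ f x y z → f x y z ≤ symmetrise f x y z
  term≤symmetrise f x y z = m≤m+n (f x y z) _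

  symmetrise-swap₁₂ : ∀ f x y z → symmetrise f x y z ≡ symmetrise f y x z
  symmetrise-swap₁₂ f x y z = shuffle (f x y z) (f y x z) (f x z y) (f y z x) (f z x y) (f z y x)
    where
    shuffle : ∀ a b c d e g → a + (b + (c + (d + (e + g)))) ≡ b + (a + (d + (c + (g + e))))
    shuffle = solve-∀

  symmetrise-swap₂₃ : ∀ f x y z → symmetrise f x y z ≡ symmetrise f x z y
  symmetrise-swap₂₃ f x y z = shuffle (f x y z) (f y x z) (f x z y) (f y z x) (f z x y) (f z y x)
    where
    shuffle : ∀ a b c d e g → a + (b + (c + (d + (e + g)))) ≡ c + (e + (a + (g + (b + d))))
    shuffle = solve-∀

  symmetrise-rotate : ∀ f x y z → symmetrise f y z x ≡ symmetrise f x y z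
  symmetrise-rotate f x y z = shuffle (f x y z) (f y x z) (f x z y) (f y z x) (f z x y) (f z y x)
    where
    shuffle : ∀ a b c d e g → d + (g + (b + (e + (a + c)))) ≡ a + (b + (c + (d + (e + g))))
    shuffle = solve-∀

module _ {n : ℕ} where

  ∑³ : Triple (Fin n) → ℕ
  ∑³ F = ∑[ x < n ] ∑[ y < n ] ∑[ z < n ] F x y z

  ∑³-cong : ∀ {F G : Triple (Fin n)} → (∀ x y z → F x y z ≡ G x y z) → ∑³ F ≡ ∑³ G
  ∑³-cong F≡G = sum-cong-≗ λ x → sum-cong-≗ λ y → sum-cong-≗ (F≡G x y)

  ∑³-mono-≤ : ∀ {F G : Triple (Fin n)} → (∀ x y z → F x y z ≤ G x y z) → ∑³ F ≤ ∑³ G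
  ∑³-mono-≤ F≤G = ∑-mono-≤ λ x → ∑-mono-≤ λ y → ∑-mono-≤ (F≤G x y)

  ∑³-distrib-+ : ∀ F G → ∑³ (F ⊕ G) ≡ ∑³ F + ∑³ G
  ∑³-distrib-+ F G =
    trans (sum-cong-≗ λ x → trans (sum-cong-≗ λ y → ∑-distrib-+ (F x y) (G x y))
                                  (∑-distrib-+ (∑ᶻ F x) (∑ᶻ G x)))
          (∑-distrib-+ (λ x → ∑[ y < n ] ∑ᶻ F x y) (λ x → ∑[ y < n ] ∑ᶻ G x y))
    where
    ∑ᶻ : Triple (Fin n) → Fin n → Fin n → ℕ
    ∑ᶻ H x y = ∑[ z < n ] H x y z

  ∑³-*ˡ : ∀ c F → ∑³ (λ x y z → c * F x y z) ≡ c * ∑³ F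
  ∑³-*ˡ c F = sym (trans (*-distribˡ-sum c (λ x → ∑[ y < n ] ∑[ z < n ] F x y z))
    (sum-cong-≗ λ x → trans (*-distribˡ-sum c (λ y → ∑[ z < n ] F x y z))
    (sum-cong-≗ λ y → *-distribˡ-sum c (F x y))))

  ∑³-swap₁₂ : ∀ F → ∑³ (swap₁₂ F) ≡ ∑³ F
  ∑³-swap₁₂ F = ∑-comm λ x y → ∑[ z < n ] F y x z

  ∑³-swap₂₃ : ∀ F → ∑³ (swap₂₃ F) ≡ ∑³ F
  ∑³-swap₂₃ F = sum-cong-≗ λ x → ∑-comm λ y z → F x z y

  ⟨_,_⟩ : Triple (Fin n) → Triple (Fin n) → ℕ
  ⟨ o , f ⟩ = ∑³ (o ⊗ f)

  ⟨⟩-distribʳ : ∀ o f g → ⟨ o , f ⊕ g ⟩ ≡ ⟨ o , f ⟩ + ⟨ o , g ⟩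
  ⟨⟩-distribʳ o f g =
    trans (∑³-cong λ x y z → *-distribˡ-+ (o x y z) (f x y z) (g x y z)) (∑³-distrib-+ _ _)

  ⟨⟩-distribˡ : ∀ o o′ f → ⟨ o ⊕ o′ , f ⟩ ≡ ⟨ o , f ⟩ + ⟨ o′ , f ⟩
  ⟨⟩-distribˡ o o′ f =
    trans (∑³-cong λ x y z → *-distribʳ-+ (f x y z) (o x y z) (o′ x y z)) (∑³-distrib-+ _ _)

  record _IsAdjointTo_ (σ σ* : Triple (Fin n) → Triple (Fin n)) : Set where
    constructor adjoint
    field ⟨⟩-adjoint : ∀ o f → ⟨ o , σ f ⟩ ≡ ⟨ σ* o , f ⟩
  open _IsAdjointTo_

  id-adjoint : id IsAdjointTo id
  id-adjoint = adjoint λ o f → refl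

  swap₁₂-adjoint : swap₁₂ IsAdjointTo swap₁₂
  swap₁₂-adjoint = adjoint λ o f → ∑³-swap₁₂ (swap₁₂ o ⊗ f)

  swap₂₃-adjoint : swap₂₃ IsAdjointTo swap₂₃
  swap₂₃-adjoint = adjoint λ o f → ∑³-swap₂₃ (swap₂₃ o ⊗ f)

  ∘-adjoint : ∀ {σ σ* τ τ*} → σ IsAdjointTo σ* → τ IsAdjointTo τ* → (σ ∘ τ) IsAdjointTo (τ* ∘ σ*)
  ∘-adjoint {σ* = σ*} {τ} (adjoint σ-adj) (adjoint τ-adj) =
    adjoint λ o f → trans (σ-adj o (τ f)) (τ-adj (σ* o) f)

  ⊕-adjoint : ∀ {σ σ* τ τ*} → σ IsAdjointTo σ* → τ IsAdjointTo τ* →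
              (λ f → σ f ⊕ τ f) IsAdjointTo (λ o → σ* o ⊕ τ* o)
  ⊕-adjoint {σ} {σ*} {τ} {τ*} (adjoint σ-adj) (adjoint τ-adj) = adjoint λ o f → begin
    ⟨ o , σ f ⊕ τ f ⟩            ≡⟨ ⟨⟩-distribʳ o (σ f) (τ f) ⟩
    ⟨ o , σ f ⟩ + ⟨ o , τ f ⟩    ≡⟨ cong₂ _+_ (σ-adj o f) (τ-adj o f) ⟩
    ⟨ σ* o , f ⟩ + ⟨ τ* o , f ⟩  ≡⟨ ⟨⟩-distribˡ (σ* o) (τ* o) f ⟨
    ⟨ σ* o ⊕ τ* o , f ⟩          ∎
    where open ≡-Reasoning

  symmetrise-selfAdjoint : ∀ o f → ⟨ o , symmetrise f ⟩ ≡ ⟨ symmetrise o , f ⟩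
  symmetrise-selfAdjoint o f =
    trans (⟨⟩-adjoint adjointness o f) (∑³-cong λ x y z → cong (_* f x y z) (reorder x y z))
    where
    -- the adjoint of a 3-cycle is the other 3-cycle, so the two change places
    symmetrise⁺ : Triple (Fin n) → Triple (Fin n)
    symmetrise⁺ g = g ⊕ swap₁₂ g ⊕ swap₂₃ g
                  ⊕ swap₂₃ (swap₁₂ g) ⊕ swap₁₂ (swap₂₃ g) ⊕ swap₁₂ (swap₂₃ (swap₁₂ g))
    adjointness : symmetrise IsAdjointTo symmetrise⁺
    adjointness =
      ⊕-adjoint id-adjoint (⊕-adjoint swap₁₂-adjoint (⊕-adjoint swap₂₃-adjoint
      (⊕-adjoint (∘-adjoint swap₁₂-adjoint swap₂₃-adjoint)
      (⊕-adjoint (∘-adjoint swap₂₃-adjoint swap₁₂-adjoint)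
                 (∘-adjoint swap₁₂-adjoint (∘-adjoint swap₂₃-adjoint swap₁₂-adjoint))))))
    reorder : ∀ x y z → symmetrise⁺ o x y z ≡ symmetrise o x y z
    reorder x y z = cong (λ m → o x y z + (o y x z + (o x z y + m))) (x∙yz≈y∙xz (o z x y) (o y z x) (o z y x))

sorted-wlog : (Q : ℕ → ℕ → ℕ → Set) →
              (∀ {x y z} → Q x y z → Q y x z) → (∀ {x y z} → Q x y z → Q x z y) →
              (∀ {x y z} → x ≤ y → y ≤ z → Q x y z) → ∀ x y z → Q x y z
sorted-wlog Q Q-swap₁₂ Q-swap₂₃ Q-sorted x y z with ≤-total x y | ≤-total y z
... | inj₁ x≤y | inj₁ y≤z = Q-sorted x≤y y≤z
... | inj₂ y≤x | inj₂ z≤y = Q-swap₁₂ (Q-swap₂₃ (Q-swap₁₂ (Q-sorted z≤y y≤x)))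
... | inj₁ x≤y | inj₂ z≤y with ≤-total x z
...   | inj₁ x≤z = Q-swap₂₃ (Q-sorted x≤z z≤y)
...   | inj₂ z≤x = Q-swap₂₃ (Q-swap₁₂ (Q-sorted z≤x x≤y))
sorted-wlog Q Q-swap₁₂ Q-swap₂₃ Q-sorted x y z | inj₂ y≤x | inj₁ y≤z with ≤-total x z
...   | inj₁ x≤z = Q-swap₁₂ (Q-sorted y≤x x≤z)
...   | inj₂ z≤x = Q-swap₁₂ (Q-swap₂₃ (Q-sorted y≤z z≤x))

<ᵇ-true : ∀ {m n} → m < n → (m <ᵇ n) ≡ true
<ᵇ-true {m} {n} = dec-true (m <? n)

<ᵇ-false : ∀ {m n} → n ≤ m → (m <ᵇ n) ≡ false
<ᵇ-false {m} {n} n≤m = dec-false (m <? n) (≤⇒≯ n≤m)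

-- symmetrise ascending is the indicator of pairwise distinct triples; this turns sums over
-- ascending triples, as in countTriangles, into sums over all triples.
ascending : Triple ℕ
ascending x y z = 𝟙 ((x <ᵇ y) ∧ (y <ᵇ z))

ascending-≥ˡ : ∀ {x y} z → y ≤ x → ascending x y z ≡ 0
ascending-≥ˡ z y≤x rewrite <ᵇ-false y≤x = refl

ascending-≥ʳ : ∀ x {y z} → z ≤ y → ascending x y z ≡ 0
ascending-≥ʳ x {y} z≤y rewrite <ᵇ-false z≤y = cong 𝟙 (∧-zeroʳ (x <ᵇ y))

symmetrise-ascending-sorted : ∀ {x y z} → x ≤ y → y ≤ z → symmetrise ascending x y z ≡ ascending x y z
symmetrise-ascending-sorted {x} {y} {z} x≤y y≤z
  rewrite ascending-≥ˡ z x≤y | ascending-≥ʳ x y≤z | ascending-≥ʳ y (≤-trans x≤y y≤z)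
        | ascending-≥ˡ y (≤-trans x≤y y≤z) | ascending-≥ˡ x y≤z = +-identityʳ (ascending x y z)

symmetrise-ascending≤1 : ∀ x y z → symmetrise ascending x y z ≤ 1
symmetrise-ascending≤1 = sorted-wlog (λ x y z → symmetrise ascending x y z ≤ 1)
  (λ {x} {y} {z} → subst (_≤ 1) (symmetrise-swap₁₂ ascending x y z))
  (λ {x} {y} {z} → subst (_≤ 1) (symmetrise-swap₂₃ ascending x y z))
  (λ x≤y y≤z → subst (_≤ 1) (sym (symmetrise-ascending-sorted x≤y y≤z)) (𝟙≤1 _))

1≤symmetrise-ascending : ∀ x y z → x ≢ y → y ≢ z → x ≢ z → 1 ≤ symmetrise ascending x y z
1≤symmetrise-ascending = sorted-wlog Distinct⇒1≤
  (λ {x} {y} {z} q y≢x x≢z y≢z →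
     subst (1 ≤_) (symmetrise-swap₁₂ ascending x y z) (q (≢-sym y≢x) y≢z x≢z))
  (λ {x} {y} {z} q x≢z z≢y x≢y →
     subst (1 ≤_) (symmetrise-swap₂₃ ascending x y z) (q x≢y (≢-sym z≢y) x≢z))
  sorted
  where
  Distinct⇒1≤ : ℕ → ℕ → ℕ → Set
  Distinct⇒1≤ x y z = x ≢ y → y ≢ z → x ≢ z → 1 ≤ symmetrise ascending x y z
  sorted : ∀ {x y z} → x ≤ y → y ≤ z → Distinct⇒1≤ x y z
  sorted x≤y y≤z x≢y y≢z _
    rewrite <ᵇ-true (≤∧≢⇒< x≤y x≢y) | <ᵇ-true (≤∧≢⇒< y≤z y≢z) = m≤m+n 1 _

-- Orientations with bounded out-degree

record BoundedOrientation {n} (E : Fin n → Fin n → Set) (k : ℕ) : Set where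
  field
    arc        : Fin n → Fin n → Bool
    arc⇒edge   : ∀ {u v} → arc u v ≡ true → E u v
    edge⇒arc   : ∀ {u v} → E u v → arc u v ≡ true ⊎ arc v u ≡ true
    arc-asym   : ∀ {u v} → arc u v ≡ true → arc v u ≡ false
    outdegree≤ : ∀ u → ∑[ v < n ] 𝟙 (arc u v) ≤ k

colourClasses-orientation : ∀ {n k} {E : Fin n → Fin n → Set} (c : Fin n → Fin n → Fin k) →
  (∀ {u v} → E u v → c u v ≡ c v u) → (∀ j → BoundedOrientation (λ u v → E u v × c u v ≡ j) 1) →
  BoundedOrientation E k
colourClasses-orientation {n} {k} {E} c c-sym class = record
  { arc = arc ; arc⇒edge = arc⇒edge ; edge⇒arc = edge⇒arc ; arc-asym = arc-asym ; outdegree≤ = outdegree≤ }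
  where
  module Class j = BoundedOrientation (class j)

  arc : Fin n → Fin n → Bool
  arc u v = Class.arc (c u v) u v

  arc⇒edge : ∀ {u v} → arc u v ≡ true → E u v
  arc⇒edge {u} {v} = proj₁ ∘ Class.arc⇒edge (c u v)

  edge⇒arc : ∀ {u v} → E u v → arc u v ≡ true ⊎ arc v u ≡ true
  edge⇒arc {u} {v} uv with Class.edge⇒arc (c u v) (uv , refl)
  ... | inj₁ u→v = inj₁ u→v
  ... | inj₂ v→u rewrite c-sym uv = inj₂ v→u

  arc-asym : ∀ {u v} → arc u v ≡ true → arc v u ≡ false
  arc-asym {u} {v} u→v rewrite sym (c-sym (arc⇒edge u→v)) = Class.arc-asym (c u v) u→v

  outdegree≤ : ∀ u → ∑[ v < n ] 𝟙 (arc u v) ≤ k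
  outdegree≤ u = begin
    ∑[ v < n ] 𝟙 (arc u v)                    ≤⟨ ∑-mono-≤ (λ v → term≤∑ (λ j → 𝟙 (Class.arc j u v)) (c u v)) ⟩
    ∑[ v < n ] ∑[ j < k ] 𝟙 (Class.arc j u v)  ≡⟨ ∑-comm (λ v j → 𝟙 (Class.arc j u v)) ⟩
    ∑[ j < k ] ∑[ v < n ] 𝟙 (Class.arc j u v)  ≤⟨ ∑-mono-≤ (λ j → Class.outdegree≤ j u) ⟩
    ∑[ j < k ] 1                              ≡⟨ ∑-const-1 k ⟩
    k                                         ∎
    where open ≤-Reasoning

-- Forests

atMostOne⊎twoDistinct : ∀ {n} {P : Fin n → Set} → Decidable P →
                        AtMostOne P ⊎ ∃₂ λ x y → P x × P y × x ≢ y
atMostOne⊎twoDistinct {P = P} P? with Fin.any? P?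
... | no none = inj₁ λ px _ → ⊥-elim (none (_ , px))
... | yes (x , px) with Fin.any? (λ y → P? y ×-dec ¬? (y Fin.≟ x))
...   | yes (y , py , y≢x) = inj₂ (x , y , px , py , ≢-sym y≢x)
...   | no noOther = inj₁ λ pa pb → trans (onlyX pa) (sym (onlyX pb))
  where
  onlyX : ∀ {y} → P y → y ≡ x
  onlyX {y} py = decidable-stable (y Fin.≟ x) λ y≢x → noOther (y , py , y≢x)

Least : (ℕ → Set) → Set
Least P = ∃ λ k → P k × (∀ {j} → j < k → ¬ P j)

leastWitness : ∀ {P : ℕ → Set} → Decidable P → ∀ {m} → P m → Least P
leastWitness {P} P? {m} = <-rec (λ m → P m → Least P) search m
  where
  search : ∀ m → (∀ {j} → j < m → P j → Least P) → P m → Least P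
  search m below pm with anyUpTo? P? m
  ... | yes (j , j<m , pj) = below j<m pj
  ... | no  none           = m , pm , λ j<m pj → none (_ , j<m , pj)

module _ {n} {R : Fin n → Fin n → Set} where

  closedWalk⇒cycle : (w : ℕ → Fin n) → (∀ i → R (w i) (w (suc i))) → ∀ m →
    Injective _≡_ _≡_ (λ (t : Fin (3 + m)) → w (toℕ t)) → w (3 + m) ≡ w 0 → HasCycle R
  closedWalk⇒cycle w step m injective closed = m , w ∘ toℕ , injective , edge , closing
    where
    edge : ∀ (i : Fin (2 + m)) → R (w (toℕ (inject₁ i))) (w (suc (toℕ i)))
    edge i rewrite Fin.toℕ-inject₁ i = step (toℕ i)
    closing : R (w (toℕ (fromℕ (2 + m)))) (w 0)
    closing rewrite Fin.toℕ-fromℕ (2 + m) = subst (R (w (2 + m))) closed (step (2 + m))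

  RepeatsAt : (ℕ → Fin n) → ℕ → Set
  RepeatsAt w b = ∃ λ a → a < b × w a ≡ w b

  repeatsAt? : ∀ w → Decidable (RepeatsAt w)
  repeatsAt? w b = anyUpTo? (λ a → w a Fin.≟ w b) b

  pigeonholeRepeat : ∀ w → ∃ (RepeatsAt w)
  pigeonholeRepeat w with Fin.pigeonhole (n<1+n n) (w ∘ toℕ)
  ... | i , j , i<j , wi≡wj = toℕ j , toℕ i , i<j , wi≡wj

  -- If b is the first time the walk revisits a vertex, last seen at time a, then w a , … , w (b ∸ 1)
  -- is a cycle: b ∸ a = 1 would be a loop and b ∸ a = 2 a step back.
  nonBacktrackingWalk⇒cycle : (∀ {v} → ¬ R v v) → (w : ℕ → Fin n) → (∀ i → R (w i) (w (suc i))) →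
                              (∀ i → w (2 + i) ≢ w i) → HasCycle R
  nonBacktrackingWalk⇒cycle irreflexive w step nonBacktracking
    with leastWitness (repeatsAt? w) (proj₂ (pigeonholeRepeat w))
  ... | b , (a , a<b , wa≡wb) , earlier with b ∸ a | m∸n+n≡m (<⇒≤ a<b)
  ...   | zero              | refl = ⊥-elim (<-irrefl refl a<b)
  ...   | 1                 | refl = ⊥-elim (irreflexive (subst (R (w a)) (sym wa≡wb) (step a)))
  ...   | 2                 | refl = ⊥-elim (nonBacktracking a (sym wa≡wb))
  ...   | suc (suc (suc m)) | refl =
          closedWalk⇒cycle (λ i → w (i + a)) (λ i → step (i + a)) m injective (sym wa≡wb)
    where
    injective : Injective _≡_ _≡_ (λ (t : Fin (3 + m)) → w (toℕ t + a))
    injective {s} {t} ws≡wt with <-cmp (toℕ s) (toℕ t)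
    ... | tri≈ _ s≡t _ = Fin.toℕ-injective s≡t
    ... | tri< s<t _ _ = ⊥-elim (earlier (+-monoˡ-< a (Fin.toℕ<n t)) (_ , +-monoˡ-< a s<t , ws≡wt))
    ... | tri> _ _ t<s = ⊥-elim (earlier (+-monoˡ-< a (Fin.toℕ<n s)) (_ , +-monoˡ-< a t<s , sym ws≡wt))

module Forest {n} {R : Fin n → Fin n → Set} (R? : ∀ u v → Dec (R u v)) (R-sym : ∀ {u v} → R u v → R v u)
  (R-irrefl : ∀ {v} → ¬ R v v) (R-acyclic : ¬ HasCycle R) where

  Neighbour : Subset n → Fin n → Fin n → Set
  Neighbour S v x = x ∈ S × R v x

  Leaf : Subset n → Fin n → Set
  Leaf S v = AtMostOne (Neighbour S v)

  Branching : Subset n → Fin n → Set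
  Branching S v = ∃₂ λ x y → Neighbour S v x × Neighbour S v y × x ≢ y

  leaf⊎branching : ∀ S v → Leaf S v ⊎ Branching S v
  leaf⊎branching S v = atMostOne⊎twoDistinct λ x → (x ∈? S) ×-dec R? v x

  leaf? : ∀ S v → Dec (Leaf S v)
  leaf? S v with leaf⊎branching S v
  ... | inj₁ leaf                    = yes leaf
  ... | inj₂ (x , y , nx , ny , x≢y) = no λ leaf → x≢y (leaf nx ny)

  record Step (S : Subset n) : Set where
    field
      from to : Fin n
      to∈S    : to ∈ S
      edge    : R from to

  branching⇒cycle : ∀ {S v₀} → v₀ ∈ S → (∀ {v} → v ∈ S → Branching S v) → HasCycle R
  branching⇒cycle {S} {v₀} v₀∈S branching =
    nonBacktrackingWalk⇒cycle {R = R} R-irrefl (Step.from ∘ walk) (Step.edge ∘ walk) (avoids ∘ walk)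
    where
    avoiding : ∀ {v} → Branching S v → (p : Fin n) → ∃ λ z → Neighbour S v z × z ≢ p
    avoiding (x , y , nx , ny , x≢y) p with x Fin.≟ p
    ... | yes refl = y , ny , x≢y ∘ sym
    ... | no x≢p   = x , nx , x≢p

    next : Step S → Step S
    next s = record
      { from = Step.to s ; to = proj₁ z ; to∈S = proj₁ (proj₁ (proj₂ z)) ; edge = proj₂ (proj₁ (proj₂ z)) }
      where z = avoiding (branching (Step.to∈S s)) (Step.from s)

    avoids : ∀ s → Step.to (next s) ≢ Step.from s
    avoids s = proj₂ (proj₂ (avoiding (branching (Step.to∈S s)) (Step.from s)))

    start : Step S
    start with branching v₀∈S
    ... | x , _ , (x∈S , v₀x) , _ = record { from = v₀ ; to = x ; to∈S = x∈S ; edge = v₀x }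

    walk : ℕ → Step S
    walk zero    = start
    walk (suc i) = next (walk i)

  leafExists : ∀ {S v₀} → v₀ ∈ S → ∃ λ v → v ∈ S × Leaf S v
  leafExists {S} v₀∈S with Fin.any? (λ v → (v ∈? S) ×-dec leaf? S v)
  ... | yes leaf  = leaf
  ... | no noLeaf = ⊥-elim (R-acyclic (branching⇒cycle v₀∈S branching))
    where
    branching : ∀ {v} → v ∈ S → Branching S v
    branching {v} v∈S with leaf⊎branching S v
    ... | inj₁ leaf = ⊥-elim (noLeaf (v , v∈S , leaf))
    ... | inj₂ b    = b

  record EliminationOrder (S : Subset n) : Set where
    field
      rank              : Fin n → ℕ
      rank-injective    : ∀ {u v} → u ∈ S → v ∈ S → rank u ≡ rank v → u ≡ v
      laterNeighbours≤1 : ∀ {u} → u ∈ S → AtMostOne (λ v → Neighbour S u v × rank u < rank v)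

  emptyOrder : ∀ {S} → (∀ {v} → v ∉ S) → EliminationOrder S
  emptyOrder ∉S = record
    { rank              = λ _ → 0
    ; rank-injective    = λ u∈S → ⊥-elim (∉S u∈S)
    ; laterNeighbours≤1 = λ u∈S → ⊥-elim (∉S u∈S)
    }

  prependLeaf : ∀ {S v} → v ∈ S → Leaf S v → EliminationOrder (S - v) → EliminationOrder S
  prependLeaf {S} {v} v∈S leaf order = record
    { rank = rank ; rank-injective = rank-injective ; laterNeighbours≤1 = laterNeighbours≤1 }
    where
    module Rest = EliminationOrder order

    rank : Fin n → ℕ
    rank u = if does (u Fin.≟ v) then 0 else suc (Rest.rank u)

    rank-injective : ∀ {u w} → u ∈ S → w ∈ S → rank u ≡ rank w → u ≡ w
    rank-injective {u} {w} u∈S w∈S ru≡rw with u Fin.≟ v | w Fin.≟ v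
    ... | yes u≡v | yes w≡v = trans u≡v (sym w≡v)
    ... | yes _   | no _    = ⊥-elim (0≢1+n ru≡rw)
    ... | no _    | yes _   = ⊥-elim (0≢1+n (sym ru≡rw))
    ... | no u≢v  | no w≢v  =
      Rest.rank-injective (x∈p∧x≢y⇒x∈p-y u∈S u≢v) (x∈p∧x≢y⇒x∈p-y w∈S w≢v) (suc-injective ru≡rw)

    laterNeighbours≤1 : ∀ {u} → u ∈ S → AtMostOne (λ x → Neighbour S u x × rank u < rank x)
    laterNeighbours≤1 {u} u∈S with u Fin.≟ v
    ... | yes refl = λ (nx , _) (ny , _) → leaf nx ny
    ... | no u≢v   = λ x-later y-later →
      Rest.laterNeighbours≤1 (x∈p∧x≢y⇒x∈p-y u∈S u≢v) (inRest x-later) (inRest y-later)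
      where
      inRest : ∀ {x} → Neighbour S u x × suc (Rest.rank u) < rank x →
               Neighbour (S - v) u x × Rest.rank u < Rest.rank x
      inRest {x} ((x∈S , ux) , u<x) with x Fin.≟ v
      ... | yes _  = ⊥-elim (n≮0 u<x)
      ... | no x≢v = (x∈p∧x≢y⇒x∈p-y x∈S x≢v , ux) , s<s⁻¹ u<x

  eliminationOrder : ∀ s S → ∣ S ∣ < s → EliminationOrder S
  eliminationOrder (suc s) S ∣S∣<1+s with nonempty? S
  ... | no empty = emptyOrder λ v∈S → empty (_ , v∈S)
  ... | yes (_ , v₀∈S) with leafExists v₀∈S
  ...   | v , v∈S , leaf =
          prependLeaf v∈S leaf
            (eliminationOrder s (S - v) (<-≤-trans (x∈p⇒∣p-x∣<∣p∣ v∈S) (s≤s⁻¹ ∣S∣<1+s)))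

  forestOrientation : BoundedOrientation R 1
  forestOrientation = record
    { arc = arc ; arc⇒edge = proj₁ ∘ later ; edge⇒arc = edge⇒arc
    ; arc-asym = arc-asym ; outdegree≤ = outdegree≤ }
    where
    open EliminationOrder (eliminationOrder (suc n) ⊤ (s≤s (∣p∣≤n ⊤)))

    arc : Fin n → Fin n → Bool
    arc u v = does (R? u v ×-dec rank u <? rank v)

    later : ∀ {u v} → arc u v ≡ true → R u v × rank u < rank v
    later {u} {v} = dec-true⁻¹ (R? u v ×-dec rank u <? rank v)

    edge⇒arc : ∀ {u v} → R u v → arc u v ≡ true ⊎ arc v u ≡ true
    edge⇒arc {u} {v} uv with <-cmp (rank u) (rank v)
    ... | tri< u<v _ _ = inj₁ (dec-true (R? u v ×-dec rank u <? rank v) (uv , u<v))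
    ... | tri≈ _ u≡v _ = ⊥-elim (R-irrefl (subst (R u) (sym (rank-injective ∈⊤ ∈⊤ u≡v)) uv))
    ... | tri> _ _ v<u = inj₂ (dec-true (R? v u ×-dec rank v <? rank u) (R-sym uv , v<u))

    arc-asym : ∀ {u v} → arc u v ≡ true → arc v u ≡ false
    arc-asym {u} {v} u→v = dec-false (R? v u ×-dec rank v <? rank u) λ (_ , v<u) → <-asym (proj₂ (later u→v)) v<u

    outdegree≤ : ∀ u → ∑[ v < n ] 𝟙 (arc u v) ≤ 1
    outdegree≤ u =
      ∑𝟙≤1 (arc u) λ u→x u→y → laterNeighbours≤1 ∈⊤ (asNeighbour u→x) (asNeighbour u→y)
      where
      asNeighbour : ∀ {x} → arc u x ≡ true → Neighbour ⊤ u x × rank u < rank x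
      asNeighbour u→x = (∈⊤ , proj₁ (later u→x)) , proj₂ (later u→x)

forestDecomposition⇒orientation : ∀ {n k} (G : Graph n) → ForestDecomposition G k →
                                  BoundedOrientation (λ u v → adj G u v ≡ true) k
forestDecomposition⇒orientation G (c , c-sym , acyclic) =
  colourClasses-orientation c (λ {u} {v} → c-sym u v) λ j →
    Forest.forestOrientation (λ u v → (adj G u v Bool.≟ true) ×-dec (c u v Fin.≟ j)) symmetric loopless (acyclic j)
  where
  loopless : ∀ {j v} → ¬ (adj G v v ≡ true × c v v ≡ j)
  loopless {v = v} (vv , _) with () ← trans (sym vv) (irrefl G v)
  symmetric : ∀ {j u v} → adj G u v ≡ true × c u v ≡ j → adj G v u ≡ true × c v u ≡ j
  symmetric {u = u} {v} (uv , cuv≡j) = trans (Graph.sym G v u) uv , trans (sym (c-sym u v uv)) cuv≡j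

-- Counting triangles

module Triangles {n} (G : Graph n) where

  private
    A = adj G

  ascendingᶠ : Triple (Fin n)
  ascendingᶠ x y z = ascending (toℕ x) (toℕ y) (toℕ z)

  triangleWith : (Fin n → Fin n → Fin n → Bool) → Fin n → Fin n → Fin n → Bool
  triangleWith P x y z = A x y ∧ A y z ∧ A x z ∧ P x y z

  countTriangles≡⟨ascending⟩ : ∀ P →
    countTriangles G P ≡ ⟨ ascendingᶠ , (λ x y z → 𝟙 (triangleWith P x y z)) ⟩
  countTriangles≡⟨ascending⟩ P =
    trans (listSum-allFin λ x → listSum (List.map (λ y → count (inOrder x y)) (allFin n)))
    (sum-cong-≗ λ x → trans (listSum-allFin λ y → count (inOrder x y))
    (sum-cong-≗ λ y → trans (count≡∑𝟙 (inOrder x y))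
    (sum-cong-≗ λ z → 𝟙-∧-∧ (toℕ x <ᵇ toℕ y) (toℕ y <ᵇ toℕ z) (triangleWith P x y z))))
    where
    inOrder : Fin n → Fin n → Fin n → Bool
    inOrder x y z = (toℕ x <ᵇ toℕ y) ∧ (toℕ y <ᵇ toℕ z) ∧ triangleWith P x y z

  edgeTriangles-sym : ∀ u v → edgeTriangles G u v ≡ edgeTriangles G v u
  edgeTriangles-sym u v = trans (count≡∑𝟙 λ w → A u w ∧ A v w)
    (trans (sum-cong-≗ λ w → cong 𝟙 (∧-comm (A u w) (A v w))) (sym (count≡∑𝟙 λ w → A v w ∧ A u w)))

  triangle : Fin n → Fin n → Fin n → Bool
  triangle x y z = A x y ∧ A y z ∧ A x z

  numTriangles≡⟨ascending⟩ : numTriangles G ≡ ⟨ ascendingᶠ , (λ x y z → 𝟙 (triangle x y z)) ⟩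
  numTriangles≡⟨ascending⟩ = trans (countTriangles≡⟨ascending⟩ _)
    (∑³-cong λ x y z → cong (λ b → ascendingᶠ x y z * 𝟙 (A x y ∧ A y z ∧ b)) (∧-identityʳ (A x z)))

  triangle-swap₂₃ : ∀ x y z → triangle x z y ≡ triangle x y z
  triangle-swap₂₃ x y z rewrite Graph.sym G z y = ∧-reverse (A x z) (A y z) (A x y)

  triangle-rotate : ∀ x y z → triangle y z x ≡ triangle x y z
  triangle-rotate x y z rewrite Graph.sym G z x | Graph.sym G y x = ∧-rotate (A y z) (A x z) (A x y)

  adjacent⇒distinct : ∀ {u v} → A u v ≡ true → toℕ u ≢ toℕ v
  adjacent⇒distinct {u} uv u≡v with refl ← Fin.toℕ-injective u≡v with () ← trans (sym uv) (irrefl G u)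

module OrientedTriangles {n k} (G : Graph n) (O : BoundedOrientation (λ u v → adj G u v ≡ true) k) where

  open BoundedOrientation O
  open Triangles G

  private
    A = adj G

  arcs≤edge : ∀ u v → 𝟙 (arc u v) + 𝟙 (arc v u) ≤ 𝟙 (A u v)
  arcs≤edge u v with arc u v in u→v | arc v u in v→u
  ... | false | false = z≤n
  ... | true  | false rewrite arc⇒edge u→v = ≤-refl
  ... | false | true  rewrite Graph.sym G u v | arc⇒edge v→u = ≤-refl
  ... | true  | true  with () ← trans (sym v→u) (arc-asym u→v)

  wedge : Triple (Fin n)
  wedge a b c = 𝟙 (arc a b) * 𝟙 (A a c ∧ A b c)

  wedge≤symmetrise : ∀ x y z → wedge x y z ≤ symmetrise ascendingᶠ x y z * wedge x y z
  wedge≤symmetrise x y z with arc x y in x→y | A x z in xz | A y z in yz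
  ... | false | _     | _     = z≤n
  ... | true  | false | _     = z≤n
  ... | true  | true  | false = z≤n
  ... | true  | true  | true  =
    *-monoˡ-≤ 1 (1≤symmetrise-ascending (toℕ x) (toℕ y) (toℕ z)
                   (adjacent⇒distinct (arc⇒edge x→y)) (adjacent⇒distinct yz) (adjacent⇒distinct xz))

  wedgePair≤ : ∀ u v w → wedge u v w + wedge v u w ≤ 𝟙 (triangle u v w)
  wedgePair≤ u v w = begin
    𝟙 (arc u v) * 𝟙 (A u w ∧ A v w) + 𝟙 (arc v u) * 𝟙 (A v w ∧ A u w)
      ≡⟨ cong (λ b → 𝟙 (arc u v) * 𝟙 b + 𝟙 (arc v u) * 𝟙 (A v w ∧ A u w)) (∧-comm (A u w) (A v w)) ⟩
    𝟙 (arc u v) * 𝟙 (A v w ∧ A u w) + 𝟙 (arc v u) * 𝟙 (A v w ∧ A u w)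
      ≡⟨ *-distribʳ-+ (𝟙 (A v w ∧ A u w)) (𝟙 (arc u v)) (𝟙 (arc v u)) ⟨
    (𝟙 (arc u v) + 𝟙 (arc v u)) * 𝟙 (A v w ∧ A u w)
      ≤⟨ *-monoˡ-≤ (𝟙 (A v w ∧ A u w)) (arcs≤edge u v) ⟩
    𝟙 (A u v) * 𝟙 (A v w ∧ A u w)
      ≡⟨ 𝟙-∧ (A u v) (A v w ∧ A u w) ⟨
    𝟙 (triangle u v w) ∎
    where open ≤-Reasoning

  symmetrise-wedge≤ : ∀ x y z → symmetrise wedge x y z ≤ 3 * 𝟙 (triangle x y z)
  symmetrise-wedge≤ x y z = begin
    symmetrise wedge x y z
      ≡⟨ pairUp (wedge x y z) (wedge y x z) (wedge x z y) (wedge y z x) (wedge z x y) (wedge z y x) ⟩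
    (wedge x y z + wedge y x z) + (wedge x z y + wedge z x y) + (wedge y z x + wedge z y x)
      ≤⟨ +-mono-≤ (+-mono-≤ (wedgePair≤ x y z) (wedgePair≤ x z y)) (wedgePair≤ y z x) ⟩
    𝟙 (triangle x y z) + 𝟙 (triangle x z y) + 𝟙 (triangle y z x)
      ≡⟨ cong₂ (λ a b → 𝟙 (triangle x y z) + 𝟙 a + 𝟙 b)
               (triangle-swap₂₃ x y z) (triangle-rotate x y z) ⟩
    𝟙 (triangle x y z) + 𝟙 (triangle x y z) + 𝟙 (triangle x y z)
      ≡⟨ thrice (𝟙 (triangle x y z)) ⟩
    3 * 𝟙 (triangle x y z) ∎
    where
    open ≤-Reasoning
    pairUp : ∀ a b c d e f → a + (b + (c + (d + (e + f)))) ≡ (a + b) + (c + e) + (d + f)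
    pairUp = solve-∀
    thrice : ∀ t → t + t + t ≡ 3 * t
    thrice = solve-∀

  ∑arcs*edgeTriangles≤3T : ∑[ a < n ] ∑[ b < n ] (𝟙 (arc a b) * edgeTriangles G a b) ≤ 3 * numTriangles G
  ∑arcs*edgeTriangles≤3T = begin
    ∑[ a < n ] ∑[ b < n ] (𝟙 (arc a b) * edgeTriangles G a b)
      ≡⟨ sum-cong-≗ (λ a → sum-cong-≗ λ b →
           trans (cong (𝟙 (arc a b) *_) (count≡∑𝟙 λ c → A a c ∧ A b c))
                 (*-distribˡ-sum (𝟙 (arc a b)) (λ c → 𝟙 (A a c ∧ A b c)))) ⟩
    ∑³ wedge
      ≤⟨ ∑³-mono-≤ wedge≤symmetrise ⟩
    ⟨ symmetrise ascendingᶠ , wedge ⟩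
      ≡⟨ symmetrise-selfAdjoint ascendingᶠ wedge ⟨
    ⟨ ascendingᶠ , symmetrise wedge ⟩
      ≤⟨ ∑³-mono-≤ (λ x y z → *-monoʳ-≤ (ascendingᶠ x y z) (symmetrise-wedge≤ x y z)) ⟩
    ∑³ (λ x y z → ascendingᶠ x y z * (3 * 𝟙 (triangle x y z)))
      ≡⟨ ∑³-cong (λ x y z → pull3 (ascendingᶠ x y z) (𝟙 (triangle x y z))) ⟩
    ∑³ (λ x y z → 3 * (ascendingᶠ x y z * 𝟙 (triangle x y z)))
      ≡⟨ ∑³-*ˡ 3 (λ x y z → ascendingᶠ x y z * 𝟙 (triangle x y z)) ⟩
    3 * ⟨ ascendingᶠ , (λ x y z → 𝟙 (triangle x y z)) ⟩
      ≡⟨ cong (3 *_) numTriangles≡⟨ascending⟩ ⟨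
    3 * numTriangles G ∎
    where
    open ≤-Reasoning
    pull3 : ∀ a t → a * (3 * t) ≡ 3 * (a * t)
    pull3 = solve-∀

  module _ (marked : Fin n → Fin n → Bool) (marked-sym : ∀ u v → marked u v ≡ marked v u) where

    allMarked : Fin n → Fin n → Fin n → Bool
    allMarked x y z = marked x y ∧ marked y z ∧ marked x z

    markedArcs : ℕ
    markedArcs = ∑[ a < n ] ∑[ b < n ] 𝟙 (arc a b ∧ marked a b)

    path : Triple (Fin n)
    path a b c = 𝟙 (arc a b ∧ marked a b) * 𝟙 (arc b c)

    path≡1 : ∀ {a b c} → arc a b ≡ true → marked a b ≡ true → arc b c ≡ true → path a b c ≡ 1
    path≡1 a→b ab b→c rewrite a→b | ab | b→c = refl

    markedTriangle≤paths : ∀ x y z → 𝟙 (triangleWith allMarked x y z) ≤ symmetrise path x y z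
    markedTriangle≤paths x y z = 𝟙-≤ λ t →
      let xy , t₁ = ∧-true⁻¹ t ; yz , t₂ = ∧-true⁻¹ t₁ ; xz , m = ∧-true⁻¹ t₂
          mxy , m₁ = ∧-true⁻¹ m ; myz , mxz = ∧-true⁻¹ m₁
      in pathIn (edge⇒arc xy) (edge⇒arc yz) (edge⇒arc xz) mxy myz mxz
      where
      flip : ∀ {u v} → marked u v ≡ true → marked v u ≡ true
      flip {u} {v} uv = trans (marked-sym v u) uv
      through : ∀ {a b c} → symmetrise path a b c ≡ symmetrise path x y z →
                arc a b ≡ true → marked a b ≡ true → arc b c ≡ true → 1 ≤ symmetrise path x y z
      through {a} {b} {c} same a→b ab b→c = subst₂ _≤_ (path≡1 a→b ab b→c) same (term≤symmetrise path a b c)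
      pathIn : arc x y ≡ true ⊎ arc y x ≡ true → arc y z ≡ true ⊎ arc z y ≡ true →
               arc x z ≡ true ⊎ arc z x ≡ true →
               marked x y ≡ true → marked y z ≡ true → marked x z ≡ true → 1 ≤ symmetrise path x y z
      pathIn (inj₁ x→y) (inj₁ y→z) _          mxy _   _   = through refl x→y mxy y→z
      pathIn (inj₂ y→x) (inj₁ _)   (inj₁ x→z) mxy _   _   =
        through (sym (symmetrise-swap₁₂ path x y z)) y→x (flip mxy) x→z
      pathIn (inj₁ _)   (inj₂ z→y) (inj₁ x→z) _   _   mxz =
        through (sym (symmetrise-swap₂₃ path x y z)) x→z mxz z→y
      pathIn (inj₂ _)   (inj₁ y→z) (inj₂ z→x) _   myz _   =
        through (symmetrise-rotate path x y z) y→z myz z→x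
      pathIn (inj₁ x→y) (inj₂ _)   (inj₂ z→x) _   _   mxz =
        through (sym (symmetrise-rotate path z x y)) z→x (flip mxz) x→y
      pathIn (inj₂ y→x) (inj₂ z→y) _          _   myz _   =
        through (trans (symmetrise-swap₂₃ path z y x) (sym (symmetrise-rotate path z x y))) z→y (flip myz) y→x

    markedTriangles≤markedArcs*k : countTriangles G allMarked ≤ markedArcs * k
    markedTriangles≤markedArcs*k = begin
      countTriangles G allMarked
        ≡⟨ countTriangles≡⟨ascending⟩ allMarked ⟩
      ⟨ ascendingᶠ , (λ x y z → 𝟙 (triangleWith allMarked x y z)) ⟩
        ≤⟨ ∑³-mono-≤ (λ x y z → *-monoʳ-≤ (ascendingᶠ x y z) (markedTriangle≤paths x y z)) ⟩
      ⟨ ascendingᶠ , symmetrise path ⟩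
        ≡⟨ symmetrise-selfAdjoint ascendingᶠ path ⟩
      ⟨ symmetrise ascendingᶠ , path ⟩
        ≤⟨ ∑³-mono-≤ (λ x y z →
             ≤-trans (*-monoˡ-≤ (path x y z) (symmetrise-ascending≤1 (toℕ x) (toℕ y) (toℕ z)))
                     (≤-reflexive (*-identityˡ (path x y z)))) ⟩
      ∑³ path
        ≡⟨ sum-cong-≗ (λ a → sum-cong-≗ λ b →
             *-distribˡ-sum (𝟙 (arc a b ∧ marked a b)) (λ c → 𝟙 (arc b c))) ⟨
      ∑[ a < n ] ∑[ b < n ] (𝟙 (arc a b ∧ marked a b) * ∑[ c < n ] 𝟙 (arc b c))
        ≤⟨ ∑-mono-≤ (λ a → ∑-mono-≤ λ b → *-monoʳ-≤ (𝟙 (arc a b ∧ marked a b)) (outdegree≤ b)) ⟩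
      ∑[ a < n ] ∑[ b < n ] (𝟙 (arc a b ∧ marked a b) * k)
        ≡⟨ ∑²-*ʳ k (λ a b → 𝟙 (arc a b ∧ marked a b)) ⟩
      markedArcs * k ∎
      where open ≤-Reasoning

    markedArcs*p≤ : ∀ {p q} → (∀ {u v} → marked u v ≡ true → p ≤ edgeTriangles G u v * q) →
                    markedArcs * p ≤ 3 * numTriangles G * q
    markedArcs*p≤ {p} {q} weight = begin
      markedArcs * p
        ≡⟨ ∑²-*ʳ p (λ a b → 𝟙 (arc a b ∧ marked a b)) ⟨
      ∑[ a < n ] ∑[ b < n ] (𝟙 (arc a b ∧ marked a b) * p)
        ≤⟨ ∑-mono-≤ (λ a → ∑-mono-≤ λ b → weighted a b) ⟩
      ∑[ a < n ] ∑[ b < n ] (𝟙 (arc a b) * edgeTriangles G a b * q)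
        ≡⟨ ∑²-*ʳ q (λ a b → 𝟙 (arc a b) * edgeTriangles G a b) ⟩
      (∑[ a < n ] ∑[ b < n ] (𝟙 (arc a b) * edgeTriangles G a b)) * q
        ≤⟨ *-monoˡ-≤ q ∑arcs*edgeTriangles≤3T ⟩
      3 * numTriangles G * q ∎
      where
      open ≤-Reasoning
      weighted : ∀ a b → 𝟙 (arc a b ∧ marked a b) * p ≤ 𝟙 (arc a b) * edgeTriangles G a b * q
      weighted a b with arc a b | marked a b in ab
      ... | false | _     = z≤n
      ... | true  | false = z≤n
      ... | true  | true  =
        subst₂ _≤_ (sym (*-identityˡ p)) (cong (_* q) (sym (*-identityˡ (edgeTriangles G a b)))) (weight ab)

    markedTriangles*p≤ : ∀ {p q} → (∀ {u v} → marked u v ≡ true → p ≤ edgeTriangles G u v * q) →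
                         countTriangles G allMarked * p ≤ 3 * numTriangles G * k * q
    markedTriangles*p≤ {p} {q} weight = begin
      countTriangles G allMarked * p  ≤⟨ *-monoˡ-≤ p markedTriangles≤markedArcs*k ⟩
      markedArcs * k * p              ≡⟨ swap markedArcs k p ⟩
      markedArcs * p * k              ≤⟨ *-monoˡ-≤ k (markedArcs*p≤ weight) ⟩
      3 * numTriangles G * q * k      ≡⟨ swap (3 * numTriangles G) q k ⟩
      3 * numTriangles G * k * q      ∎
      where
      open ≤-Reasoning
      swap : ∀ a b c → a * b * c ≡ a * c * b
      swap = solve-∀

toℚ≡mkℚ : ∀ k → toℚ k ≡ mkℚ (ℤ.+ k) 0 (Coprime.sym (Coprime.1-coprimeTo k))
toℚ≡mkℚ k = ℚP.normalize-coprime (Coprime.sym (Coprime.1-coprimeTo k))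

toℚᵘ-toℚ : ∀ k → toℚᵘ (toℚ k) ≡ mkℚᵘ (ℤ.+ k) 0
toℚᵘ-toℚ k = cong toℚᵘ (toℚ≡mkℚ k)

toℚ-* : ∀ a b → toℚ (a * b) ≡ toℚ a ℚ.* toℚ b
toℚ-* a b = ℚP.toℚᵘ-injective (begin
  toℚᵘ (toℚ (a * b))                     ≡⟨ toℚᵘ-toℚ (a * b) ⟩
  mkℚᵘ (ℤ.+ (a * b)) 0                   ≈⟨ *≡* (cong (ℤ._* ℤ.1ℤ) (ℤP.pos-* a b)) ⟩
  mkℚᵘ (ℤ.+ a) 0 ℚᵘ.* mkℚᵘ (ℤ.+ b) 0     ≡⟨ cong₂ ℚᵘ._*_ (toℚᵘ-toℚ a) (toℚᵘ-toℚ b) ⟨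
  toℚᵘ (toℚ a) ℚᵘ.* toℚᵘ (toℚ b)         ≈⟨ ℚP.toℚᵘ-homo-* (toℚ a) (toℚ b) ⟨
  toℚᵘ (toℚ a ℚ.* toℚ b)                 ∎)
  where open ℚᵘP.≃-Reasoning

toℚ-*³ : ∀ a b c → toℚ (a * b * c) ≡ toℚ a ℚ.* toℚ b ℚ.* toℚ c
toℚ-*³ a b c = trans (toℚ-* (a * b) c) (cong (ℚ._* toℚ c) (toℚ-* a b))

<toℚ⇒ : ∀ τ .{{_ : ℚ.Positive τ}} t → τ ℚ.< toℚ t → ℤ.∣ ℚ.↥ τ ∣ < t * ℚ.↧ₙ τ
<toℚ⇒ τ@(mkℚ (ℤ.+ p) d _) t τ<t = subst (_< t * suc d) (*-identityʳ p)
  (ℤP.drop‿+<+ (subst₂ ℤ._<_ (sym (ℤP.pos-* p 1)) (sym (ℤP.pos-* t (suc d)))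
    (ℚP.drop-*<* (subst (τ ℚ.<_) (toℚ≡mkℚ t) τ<t))))

toℚ*τ≤toℚ : ∀ τ .{{_ : ℚ.Positive τ}} H X → H * ℤ.∣ ℚ.↥ τ ∣ ≤ X * ℚ.↧ₙ τ →
            toℚ H ℚ.* τ ℚ.≤ toℚ X
toℚ*τ≤toℚ τ@(mkℚ (ℤ.+ p) d _) H X le =
  ℚP.toℚᵘ-cancel-≤ (ℚᵘP.≤-respˡ-≃ (ℚᵘP.≃-sym (ℚP.toℚᵘ-homo-* (toℚ H) τ)) inℚᵘ)
  where
  -- the denominator of the unnormalised product normalises to suc (d + 0)
  inℚᵘ : toℚᵘ (toℚ H) ℚᵘ.* toℚᵘ τ ℚᵘ.≤ toℚᵘ (toℚ X)
  inℚᵘ rewrite toℚᵘ-toℚ H | toℚᵘ-toℚ X | ℤP.+◃n≡+n (H * p) | +-identityʳ d =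
    ℚᵘ.*≤* (subst₂ ℤ._≤_ (sym (ℤP.*-identityʳ (ℤ.+ (H * p)))) (ℤP.pos-* X (suc d)) (ℤ.+≤+ le))

≤-÷ : ∀ {x y} τ .{{_ : ℚ.Positive τ}} → x ℚ.* τ ℚ.≤ y → x ℚ.≤ (y ℚ.÷ τ) {{ℚP.pos⇒nonZero τ}}
≤-÷ {x} {y} τ xτ≤y = ℚP.*-cancelʳ-≤-pos τ (subst (x ℚ.* τ ℚ.≤_) (sym y÷τ*τ≡y) xτ≤y)
  where
  instance
    τ≢0 : ℚ.NonZero τ
    τ≢0 = ℚP.pos⇒nonZero τ
  y÷τ*τ≡y : (y ℚ.÷ τ) ℚ.* τ ≡ y
  y÷τ*τ≡y = trans (ℚP.*-assoc y (ℚ.1/ τ) τ) (trans (cong (y ℚ.*_) (ℚP.*-inverseˡ τ)) (ℚP.*-identityʳ y))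

mainTheorem2 : ∀ {n : ℕ} (G : Graph n) (α : ℕ) (τ : ℚ) → IsArboricity G α → (τpos : ℚ.Positive τ)
    → toℚ (numHeavyTriangles G τ)
      ℚ.≤ ℚ._÷_ (toℚ 3 ℚ.* toℚ (numTriangles G) ℚ.* toℚ α) τ {{ℚP.pos⇒nonZero τ {{τpos}}}}
mainTheorem2 G α τ (forests , _) τpos = begin
  toℚ (numHeavyTriangles G τ)                     ≤⟨ ≤-÷ τ (toℚ*τ≤toℚ τ (numHeavyTriangles G τ) 3Tα bound) ⟩
  toℚ 3Tα ℚ.÷ τ                                   ≡⟨ cong (ℚ._÷ τ) (toℚ-*³ 3 (numTriangles G) α) ⟩
  toℚ 3 ℚ.* toℚ (numTriangles G) ℚ.* toℚ α ℚ.÷ τ  ∎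
  where
  open ℚP.≤-Reasoning
  instance
    τ>0 : ℚ.Positive τ
    τ>0 = τpos
    τ≢0 : ℚ.NonZero τ
    τ≢0 = ℚP.pos⇒nonZero τ
  heavy-sym : ∀ u v → heavyEdge G τ u v ≡ heavyEdge G τ v u
  heavy-sym u v = cong (λ t → does (τ ℚP.<? toℚ t)) (Triangles.edgeTriangles-sym G u v)
  heavy⇒weight : ∀ {u v} → heavyEdge G τ u v ≡ true → ℤ.∣ ℚ.↥ τ ∣ ≤ edgeTriangles G u v * ℚ.↧ₙ τ
  heavy⇒weight {u} {v} uv =
    <⇒≤ (<toℚ⇒ τ (edgeTriangles G u v) (dec-true⁻¹ (τ ℚP.<? toℚ (edgeTriangles G u v)) uv))
  3Tα : ℕ
  3Tα = 3 * numTriangles G * α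
  bound : numHeavyTriangles G τ * ℤ.∣ ℚ.↥ τ ∣ ≤ 3Tα * ℚ.↧ₙ τ
  bound = OrientedTriangles.markedTriangles*p≤ G (forestDecomposition⇒orientation G forests)
            (heavyEdge G τ) heavy-sym heavy⇒weight
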